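{- Let $T$ be a tree on $n \geq 4$ vertices which is not a path, and let $l_1$ and $l_2$ be the numbers of vertices of $T$ of degree one and degree two, respectively. Then the procedure Non-path_Augmentation applied to $T$ adds exactly $\left\lceil \frac{2l_1+l_2}{2}\right\rceil$ edges, i.e. the returned set satisfies $|E_{ca}| = \left\lceil \frac{2l_1+l_2}{2}\right\rceil$.
   Context: Procedure Non-path_Augmentation: the input is a tree $T$ with maximum degree at least 3. "Adding" an edge means inserting it into the current graph (initially $T$) and into the output set $E_{ca}$ (initially empty). Let $r$ be a vertex of maximum degree and root $T$ at $r$. Let $v_1,\ldots,v_l$ be the leaves (degree-one vertices) of $T$, in some fixed order. For $1\le i\le l$ let $B_i$ be the vertex set of the unique path in $T$ from $r$ to $v_i$. Let $W=(w_1,\ldots,w_k)$ list the degree-two vertices of $T$ in level (breadth-first) order starting from $r$; initially all of them are unmarked. For $i=1,\ldots,k$ in order: find the least $j$ with $1\le j\le i-1$ such that $w_j$ is unmarked and there exist $s\ne t$ with $w_i\in B_s$ and $w_j\in B_t$; if such $j$ exists, add the edge $\{w_i,w_j\}$ and mark $w_i$ and $w_j$. Let $x_1,\ldots,x_m$ be the vertices of $W$ still unmarked, in the order inherited from $W$. Then: (a) if $m=0$, add $\{v_i,v_{i+1}\}$ for $1\le i\le l-1$ and $\{v_1,v_l\}$; (b) if $m\ge 2$ is even, add $\{x_i,x_{m+2-i}\}$ for $2\le i\le m/2$, add $\{v_i,v_{i+1}\}$ for $1\le i\le l-1$, and then, if $\{x_{m/2+1},v_l\}\in E(T)$ add $\{x_1,v_l\}$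 and $\{x_{m/2+1},v_1\}$, otherwise add $\{x_1,v_1\}$ and $\{x_{m/2+1},v_l\}$; (c) if $m$ is odd, add $\{x_i,x_{m+1-i}\}$ for $1\le i\le (m-1)/2$, add $\{v_1,v_l\}$ and $\{v_i,v_{i+1}\}$ for $1\le i\le l-1$, and then, if $\{x_{(m+1)/2},v_l\}\in E(T)$ add $\{x_{(m+1)/2},v_1\}$, otherwise add $\{x_{(m+1)/2},v_l\}$. The procedure returns the resulting graph $H$ and the set $E_{ca}$. -}

module Defs where

open import Data.Bool using (Bool; true; false; if_then_else_; _∧_; not)
open import Data.Nat using (ℕ; zero; suc; _+_; _∸_; _≤_; _≡ᵇ_; _≤ᵇ_; ⌊_/2⌋)
open import Data.Nat.DivMod using (_%_)
open import Data.Fin using (Fin; toℕ)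
import Data.Fin as F
import Data.Fin.Properties as FP
open import Data.List using (List; []; _∷_; _++_; [_]; length; map; filterᵇ; upTo; head; last; zip; deduplicate; allFin; lookup)
open import Data.List.Membership.Propositional using (_∈_)
open import Data.List.Relation.Unary.Unique.Propositional using (Unique)
open import Data.Bool.ListAction using (any)
open import Data.Maybe using (Maybe; just; nothing)
open import Data.Product using (Σ; ∃; _×_; _,_; proj₁; proj₂)
import Data.Product.Properties as PP
open import Data.Sum using (_⊎_)
open import Data.Unit using (⊤)
open import Function.Bundles using (_⇔_)
open import Function.Definitions using (Injective)
open import Relation.Binary.PropositionalEquality using (_≡_)
open import Relation.Nullary using (¬_)

Adj : ℕ → Set
Adj n = Fin n → Fin n → Bool

Edge : ℕ → Set
Edge n = Fin n × Fin n

module _ {n : ℕ} (adj : Adj n) where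

  deg : Fin n → ℕ
  deg u = length (filterᵇ (adj u) (allFin n))

  numDeg : ℕ → ℕ
  numDeg d = length (filterᵇ (λ u → deg u ≡ᵇ d) (allFin n))

  Chain : List (Fin n) → Set
  Chain [] = ⊤
  Chain (x ∷ []) = ⊤
  Chain (x ∷ y ∷ zs) = (adj x y ≡ true) × Chain (y ∷ zs)

  data Walk : Fin n → Fin n → Set where
    here : ∀ {u} → Walk u u
    step : ∀ {u w v} → adj u w ≡ true → Walk w v → Walk u v

  -- a cycle: at least 3 distinct vertices c₀ … c_{k-1}, consecutive ones
  -- adjacent and c_{k-1} adjacent to c₀
  HasCycle : Set
  HasCycle = Σ (Fin n) λ c → Σ (List (Fin n)) λ cs →
    (2 ≤ length cs) × Unique (c ∷ cs) × Chain ((c ∷ cs) ++ [ c ])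

  IsTree : Set
  IsTree = (∀ u v → adj u v ≡ adj v u) × (∀ u → adj u u ≡ false)
         × (∀ u v → Walk u v) × ¬ HasCycle

  IsPathGraph : Set
  IsPathGraph = Σ (Fin n → Fin n) λ σ → Injective _≡_ _≡_ σ ×
    (∀ i j → (adj (σ i) (σ j) ≡ true) ⇔ ((suc (toℕ i) ≡ toℕ j) ⊎ (suc (toℕ j) ≡ toℕ i)))

  PathFromTo : Fin n → Fin n → List (Fin n) → Set
  PathFromTo u v ps = (head ps ≡ just u) × (last ps ≡ just v) × Unique ps × Chain ps

  LevelOrdered : Fin n → List (Fin n) → Set
  LevelOrdered r ws = ∀ (i j : Fin (length ws)) → i F.< j →
    ∀ p q → PathFromTo r (lookup ws i) p → PathFromTo r (lookup ws j) q →
    length p ≤ length q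

normEdge : ∀ {n} → Edge n → Edge n
normEdge (a , b) = if toℕ a ≤ᵇ toℕ b then (a , b) else (b , a)

edgeCard : ∀ {n} → List (Edge n) → ℕ
edgeCard {n} es = length (deduplicate (PP.≡-dec FP._≟_ FP._≟_) (map normEdge es))

-- Inputs: the tree adj, the root r, the predicate inB w v ("w ∈ vertex set
-- of the r–v path"), the leaves vs = v₁…v_l, the degree-two vertices
-- ws = w₁…w_k in level order.

module Proc {n : ℕ} (adj : Adj n) (r : Fin n) (inB : Fin n → Fin n → Bool)
            (vs ws : List (Fin n)) where

  l : ℕ
  l = length vs

  indexedLeaves : List (ℕ × Fin n)
  indexedLeaves = zip (upTo l) vs

  sep : Fin n → Fin n → Bool
  sep a b = any (λ { (s , vₛ) → any (λ { (t , vₜ) →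
              not (s ≡ᵇ t) ∧ inB a vₛ ∧ inB b vₜ }) indexedLeaves }) indexedLeaves

  findMark : (Fin n → Bool) → List (Fin n × Bool) → Maybe (Fin n × List (Fin n × Bool))
  findMark p [] = nothing
  findMark p ((w , true) ∷ rest) with findMark p rest
  ... | nothing = nothing
  ... | just (u , rest') = just (u , (w , true) ∷ rest')
  findMark p ((w , false) ∷ rest) with p w
  ... | true = just (w , (w , true) ∷ rest)
  ... | false with findMark p rest
  ...   | nothing = nothing
  ...   | just (u , rest') = just (u , (w , false) ∷ rest')

  -- the loop over W; state = processed prefix with marks, edges added so far
  pairLoop : List (Fin n × Bool) → List (Fin n) → List (Edge n) →
             List (Fin n × Bool) × List (Edge n)
  pairLoop st [] acc = st , acc
  pairLoop st (w ∷ rest) acc with findMark (sep w) st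
  ... | just (u , st') = pairLoop (st' ++ [ (w , true) ]) rest (acc ++ [ (w , u) ])
  ... | nothing = pairLoop (st ++ [ (w , false) ]) rest acc

  afterLoop : List (Fin n × Bool) × List (Edge n)
  afterLoop = pairLoop [] ws []

  xs : List (Fin n)
  xs = map proj₁ (filterᵇ (λ p → not (proj₂ p)) (proj₁ afterLoop))

  m : ℕ
  m = length xs

  -- 1-based access (the default r is never used for in-range indices)
  nth : List (Fin n) → ℕ → Fin n
  nth [] _ = r
  nth (y ∷ ys) zero = y
  nth (y ∷ ys) (suc k) = nth ys k

  x : ℕ → Fin n
  x i = nth xs (i ∸ 1)

  v : ℕ → Fin n
  v i = nth vs (i ∸ 1)

  range : ℕ → ℕ → List ℕ
  range a b = map (a +_) (upTo (suc b ∸ a))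

  leafPath : List (Edge n)
  leafPath = map (λ i → (v i , v (suc i))) (range 1 (l ∸ 1))

  caseA : List (Edge n)
  caseA = leafPath ++ [ (v 1 , v l) ]

  caseB : List (Edge n)
  caseB = map (λ i → (x i , x (m + 2 ∸ i))) (range 2 ⌊ m /2⌋) ++ leafPath ++
          (if adj (x (⌊ m /2⌋ + 1)) (v l)
             then (x 1 , v l) ∷ [ (x (⌊ m /2⌋ + 1) , v 1) ]
             else (x 1 , v 1) ∷ [ (x (⌊ m /2⌋ + 1) , v l) ])

  caseC : List (Edge n)
  caseC = map (λ i → (x i , x (m + 1 ∸ i))) (range 1 ⌊ (m ∸ 1) /2⌋) ++
          ((v 1 , v l) ∷ leafPath) ++
          [ (if adj (x ⌊ (m + 1) /2⌋) (v l)
               then (x ⌊ (m + 1) /2⌋ , v 1)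
               else (x ⌊ (m + 1) /2⌋ , v l)) ]

  phase2 : List (Edge n)
  phase2 = if m ≡ᵇ 0 then caseA else (if (m % 2) ≡ᵇ 0 then caseB else caseC)

  Eca : List (Edge n)
  Eca = proj₂ afterLoop ++ phase2

open Proc public using (Eca)

-- Each edge added by the pairing loop joins two unmarked degree-two vertices and marks both, so
-- if the loop adds p edges and leaves m vertices unmarked then l₂ = 2p + m.  The second phase adds
-- l₁ + ⌈m/2⌉ edges: the leaves are joined into a path or a cycle, the unmarked vertices are paired
-- off from the two ends of their list towards the middle, and the one or two left over are joined
-- to the end leaves.  No edge is added twice, because marked vertices, unmarked vertices and leaves
-- are pairwise distinct and the index ranges in the second phase are disjoint; for the closing
-- edge v₁v_l this needs l₁ ≥ 3, which holds because a tree that is not a path has a vertex of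
-- degree at least three, and the three branches at it end in three distinct leaves.
-- Hence |E_ca| = p + l₁ + ⌈m/2⌉ = ⌈(2l₁ + l₂)/2⌉.

module Submission where

open import Defs
open import Data.Bool using (Bool; true; false; not; T; if_then_else_)
open import Data.Bool.Properties as Boolₚ using (T-≡)
open import Data.Empty using (⊥-elim)
open import Data.Maybe using (Maybe; just; nothing)
open import Data.Unit using (⊤)
open import Data.Fin as Fin using (Fin; toℕ; cast)
import Data.Fin.Properties as Finₚ
open import Data.List
  using (List; []; _∷_; _++_; [_]; _∷ʳ_; length; map; filterᵇ; allFin; lookup; reverse; deduplicate; upTo; applyUpTo)
open import Data.List.Properties
  using ( ++-assoc; ++-identityʳ; filter-++; filter-all; length-++; length-map; length-upTo; length-tabulate
        ; map-++; map-∘; map-upTo; reverse-++; unfold-reverse)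
open import Data.List.Membership.Propositional using (_∈_; _∉_; lose)
open import Data.List.Membership.Propositional.Properties
  using (∈-map⁻; ∈-upTo⁻; ∈-∃++; ∈-++⁺ˡ; ∈-++⁺ʳ; ∈-++⁻; ∈-filter⁺; ∈-filter⁻; ∈-allFin; ∈-lookup)
import Data.List.Membership.DecPropositional as DecMembership
open import Data.List.Relation.Unary.All as All using (All; []; _∷_)
import Data.List.Relation.Unary.All.Properties as Allₚ
import Data.List.Relation.Unary.AllPairs.Properties as AllPairsₚ
open import Data.List.Relation.Unary.Any using (here; there; any?; satisfied)
open import Data.List.Relation.Unary.Unique.Propositional using (Unique; []; _∷_)
open import Data.List.Relation.Unary.Unique.Propositional.Properties as Uniqueₚ using (filter⁺; allFin⁺)
open import Data.List.Relation.Binary.Permutation.Propositional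
  using (_↭_; prep; swap; ↭-refl; ↭-sym; ↭-trans; ↭-reflexive; ↭⇒↭ₛ; module PermutationReasoning)
open import Data.List.Relation.Binary.Permutation.Propositional.Properties
  using (↭-reverse; ∈-resp-↭; ↭-length; ++⁺ˡ; ++⁺ʳ; shift)
import Data.List.Relation.Binary.Permutation.Setoid.Properties as PermutationSetoid
open import Data.Nat using (ℕ; zero; suc; pred; _+_; _*_; _∸_; _≤_; _<_; z≤n; s≤s; _≡ᵇ_; _≤ᵇ_; _≤?_; ⌊_/2⌋; ⌈_/2⌉)
open import Data.Nat.DivMod using (_%_)
open import Data.Nat.Tactic.RingSolver using (solve-∀)
open import Data.Nat.Properties
  using ( ≤-refl; ≤-trans; ≤-reflexive; ≤-antisym; ≤-pred; ≰⇒>; <-irrefl; <⇒≤; <⇒≢; n≤1+n; m≤n+m; m≤m+n; m<m+n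
        ; +-suc; +-comm; +-assoc; +-identityʳ; +-monoʳ-<; +-monoʳ-≤; 0∸n≡0; m+n∸m≡n; m+n∸n≡m; ∸-monoʳ-≤
        ; n≡⌊n+n/2⌋; n≡⌈n+n/2⌉; ≡ᵇ⇒≡; ≡⇒≡ᵇ)
open import Data.Product using (∃; ∃₂; _×_; _,_; proj₁; proj₂)
open import Data.Sum using (_⊎_; inj₁; inj₂)
open import Function using (_∘_)
open import Function.Bundles using (_⇔_; mk⇔; Equivalence)
open import Relation.Binary.PropositionalEquality
  using (_≡_; _≢_; refl; sym; trans; cong; cong₂; subst; subst₂; setoid; ≢-sym; module ≡-Reasoning)
open import Relation.Binary.Definitions using (DecidableEquality)
open import Relation.Nullary using (¬_; yes; no; ¬?; _×-dec_; contradiction)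
open import Relation.Nullary.Decidable using (T?)

-- Lists

module _ {a} {A : Set a} where

  Unique-++⁻ˡ : ∀ xs {ys : List A} → Unique (xs ++ ys) → Unique xs
  Unique-++⁻ˡ [] _ = []
  Unique-++⁻ˡ (x ∷ xs) (x∉ ∷ u) = All.tabulate (λ z∈ → All.lookup x∉ (∈-++⁺ˡ z∈)) ∷ Unique-++⁻ˡ xs u

  Unique-++⁻ʳ : ∀ xs {ys : List A} → Unique (xs ++ ys) → Unique ys
  Unique-++⁻ʳ [] u = u
  Unique-++⁻ʳ (x ∷ xs) (_ ∷ u) = Unique-++⁻ʳ xs u

  Unique-++-apart : ∀ xs {ys : List A} {p q} → Unique (xs ++ ys) → p ∈ xs → q ∈ ys → p ≢ q
  Unique-++-apart (x ∷ xs) (x∉ ∷ _) (here refl) q∈ = All.lookup x∉ (∈-++⁺ʳ xs q∈)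
  Unique-++-apart (x ∷ xs) (_ ∷ u) (there p∈) q∈ = Unique-++-apart xs u p∈ q∈

  Unique-resp-↭ : ∀ {xs ys : List A} → xs ↭ ys → Unique xs → Unique ys
  Unique-resp-↭ p = PermutationSetoid.Unique-resp-↭ (setoid A) (↭⇒↭ₛ p)

  ∉⇒All≢ : ∀ {y : A} {xs} → y ∉ xs → All (y ≢_) xs
  ∉⇒All≢ y∉ = All.tabulate (λ z∈ y≡z → y∉ (subst (_∈ _) (sym y≡z) z∈))

  private
    length-++-∷ : ∀ (xs : List A) {y} ys → length (xs ++ y ∷ ys) ≡ suc (length (xs ++ ys))
    length-++-∷ [] ys = refl
    length-++-∷ (_ ∷ xs) ys = cong suc (length-++-∷ xs ys)

    ∈-++-∷⁻ : ∀ (xs : List A) {y z ys} → z ∈ xs ++ y ∷ ys → z ≢ y → z ∈ xs ++ ys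
    ∈-++-∷⁻ [] (here refl) z≢y = ⊥-elim (z≢y refl)
    ∈-++-∷⁻ [] (there z∈) _ = z∈
    ∈-++-∷⁻ (x ∷ xs) (here refl) _ = here refl
    ∈-++-∷⁻ (x ∷ xs) (there z∈) z≢y = there (∈-++-∷⁻ xs z∈ z≢y)

  Unique-⊆⇒length≤ : ∀ {xs ys : List A} → Unique xs → (∀ {z} → z ∈ xs → z ∈ ys) → length xs ≤ length ys
  Unique-⊆⇒length≤ {[]} _ _ = z≤n
  Unique-⊆⇒length≤ {x ∷ xs} (x∉ ∷ u) xs⊆ys with ∈-∃++ (xs⊆ys (here refl))
  ... | ys₁ , ys₂ , refl = subst (suc (length xs) ≤_) (sym (length-++-∷ ys₁ ys₂))
          (s≤s (Unique-⊆⇒length≤ u λ z∈ →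
            ∈-++-∷⁻ ys₁ (xs⊆ys (there z∈)) (λ z≡x → All.lookup x∉ z∈ (sym z≡x))))

  Unique-same-members⇒length≡ : ∀ {xs ys : List A} → Unique xs → Unique ys →
                                (∀ z → z ∈ xs ⇔ z ∈ ys) → length xs ≡ length ys
  Unique-same-members⇒length≡ uxs uys xs≈ys =
    ≤-antisym (Unique-⊆⇒length≤ uxs (Equivalence.to (xs≈ys _)))
              (Unique-⊆⇒length≤ uys (Equivalence.from (xs≈ys _)))

  lookup-injective : ∀ {ps : List A} → Unique ps → ∀ {i j} → lookup ps i ≡ lookup ps j → i ≡ j
  lookup-injective {_ ∷ _} _ {Fin.zero} {Fin.zero} _ = refl
  lookup-injective {_ ∷ _} (x∉ ∷ _) {Fin.zero} {Fin.suc j} eq = ⊥-elim (All.lookup x∉ (∈-lookup j) eq)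
  lookup-injective {_ ∷ _} (x∉ ∷ _) {Fin.suc i} {Fin.zero} eq = ⊥-elim (All.lookup x∉ (∈-lookup i) (sym eq))
  lookup-injective {_ ∷ _} (_ ∷ u) {Fin.suc i} {Fin.suc j} eq = cong Fin.suc (lookup-injective u eq)

  deduplicate-Unique : ∀ (_≟_ : DecidableEquality A) {xs} → Unique xs → deduplicate _≟_ xs ≡ xs
  deduplicate-Unique _≟_ [] = refl
  deduplicate-Unique _≟_ {x ∷ xs} (x∉ ∷ u) rewrite deduplicate-Unique _≟_ u =
    cong (x ∷_) (filter-all (λ y → ¬? (x ≟ y)) x∉)

  lastOr : A → List A → A
  lastOr x [] = x
  lastOr _ (y ∷ ys) = lastOr y ys

  lastOr-∈ : ∀ x xs → lastOr x xs ∈ x ∷ xs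
  lastOr-∈ x [] = here refl
  lastOr-∈ _ (y ∷ ys) = there (lastOr-∈ y ys)

  lastOr-∷ʳ : ∀ x xs y → lastOr x (xs ∷ʳ y) ≡ y
  lastOr-∷ʳ x [] y = refl
  lastOr-∷ʳ _ (z ∷ zs) y = lastOr-∷ʳ z zs y

  lastOr-reverse : ∀ {h t y ys} → h ∷ t ≡ reverse (y ∷ ys) → lastOr h t ≡ y
  lastOr-reverse {h} {t} {y} {ys} eq = go _ (trans eq (unfold-reverse y ys))
    where
    go : ∀ zs → h ∷ t ≡ zs ∷ʳ y → lastOr h t ≡ y
    go [] refl = refl
    go (z ∷ zs) refl = lastOr-∷ʳ z zs y

  private
    lastOr-++ : ∀ x xs y ys → lastOr x (xs ++ y ∷ ys) ≡ lastOr y ys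
    lastOr-++ x [] y ys = refl
    lastOr-++ _ (z ∷ zs) y ys = lastOr-++ z zs y ys

  lastOr-++-≡ : ∀ xs {h t y ys} → xs ++ y ∷ ys ≡ h ∷ t → lastOr h t ≡ lastOr y ys
  lastOr-++-≡ [] refl = refl
  lastOr-++-≡ (z ∷ zs) {y = y} {ys} refl = lastOr-++ z zs y ys

Unique⇒length≤ : ∀ {n} {ps : List (Fin n)} → Unique ps → length ps ≤ n
Unique⇒length≤ {n} u =
  ≤-trans (Unique-⊆⇒length≤ u (λ {z} _ → ∈-allFin z)) (≤-reflexive (length-tabulate {n = n} (λ i → i)))

-- Graphs and trees

module Graph {n : ℕ} (adj : Adj n) where

  SimplePath : List (Fin n) → Set
  SimplePath ps = Unique ps × Chain adj ps

  Chain-++⁻ˡ : ∀ xs {ys} → Chain adj (xs ++ ys) → Chain adj xs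
  Chain-++⁻ˡ [] _ = _
  Chain-++⁻ˡ (x ∷ []) _ = _
  Chain-++⁻ˡ (x ∷ y ∷ xs) (xy , c) = xy , Chain-++⁻ˡ (y ∷ xs) c

  Chain-++⁻ʳ : ∀ xs {ys} → Chain adj (xs ++ ys) → Chain adj ys
  Chain-++⁻ʳ [] c = c
  Chain-++⁻ʳ (x ∷ []) {[]} _ = _
  Chain-++⁻ʳ (x ∷ []) {y ∷ ys} (_ , c) = c
  Chain-++⁻ʳ (x ∷ y ∷ xs) (_ , c) = Chain-++⁻ʳ (y ∷ xs) c

  Chain-∷ʳ : ∀ xs {u w} → Chain adj (xs ∷ʳ u) → adj u w ≡ true → Chain adj (xs ∷ʳ u ∷ʳ w)
  Chain-∷ʳ [] _ uw = uw , _
  Chain-∷ʳ (x ∷ []) (xu , _) uw = xu , uw , _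
  Chain-∷ʳ (x ∷ y ∷ xs) (xy , c) uw = xy , Chain-∷ʳ (y ∷ xs) c uw

  Chain-lookup : ∀ ps (i j : Fin (length ps)) → Chain adj ps → suc (toℕ i) ≡ toℕ j →
                 adj (lookup ps i) (lookup ps j) ≡ true
  Chain-lookup (x ∷ y ∷ ps) Fin.zero (Fin.suc Fin.zero) (xy , _) _ = xy
  Chain-lookup (x ∷ []) Fin.zero (Fin.suc ()) _ _
  Chain-lookup (x ∷ y ∷ ps) (Fin.suc i) (Fin.suc j) (_ , c) eq =
    Chain-lookup (y ∷ ps) i j c (cong pred eq)

  walk-within : ∀ {ps x u} → (∀ {x y} → x ∈ ps → adj x y ≡ true → y ∈ ps) → x ∈ ps → Walk adj x u → u ∈ ps
  walk-within closed x∈ here = x∈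
  walk-within closed x∈ (step xw w⇝u) = walk-within closed (closed x∈ xw) w⇝u

  neighbours : Fin n → List (Fin n)
  neighbours u = filterᵇ (adj u) (allFin n)

  ∈-neighbours⁺ : ∀ {u v} → adj u v ≡ true → v ∈ neighbours u
  ∈-neighbours⁺ {u} {v} uv = ∈-filter⁺ (λ w → T? (adj u w)) (∈-allFin v) (subst T (sym uv) _)

  ∈-neighbours⁻ : ∀ {u v} → v ∈ neighbours u → adj u v ≡ true
  ∈-neighbours⁻ {u} {v} v∈ = Equivalence.to T-≡ (proj₂ (∈-filter⁻ (λ w → T? (adj u w)) {xs = allFin n} v∈))

  neighbours-Unique : ∀ u → Unique (neighbours u)
  neighbours-Unique u = filter⁺ (λ v → T? (adj u v)) (allFin⁺ n)

  deg≡1 : ∀ {u w} → adj u w ≡ true → (∀ v → adj u v ≡ true → v ≡ w) → deg adj u ≡ 1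
  deg≡1 {w = w} uw only-w =
    ≤-antisym (Unique-⊆⇒length≤ {ys = w ∷ []} (neighbours-Unique _) (λ v∈ → here (only-w _ (∈-neighbours⁻ v∈))))
              (Unique-⊆⇒length≤ {xs = _ ∷ []} ([] ∷ []) λ { (here refl) → ∈-neighbours⁺ uw })

  three-neighbours : ∀ u → 3 ≤ deg adj u → ∃₂ λ a b → ∃ λ c →
    adj u a ≡ true × adj u b ≡ true × adj u c ≡ true × a ≢ b × a ≢ c × b ≢ c
  three-neighbours u = pick (neighbours u) (neighbours-Unique u) ∈-neighbours⁻
    where
    pick : ∀ vs → Unique vs → (∀ {v} → v ∈ vs → adj u v ≡ true) → 3 ≤ length vs → ∃₂ λ a b → ∃ λ c →
           adj u a ≡ true × adj u b ≡ true × adj u c ≡ true × a ≢ b × a ≢ c × b ≢ c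
    pick [] _ _ ()
    pick (_ ∷ []) _ _ (s≤s ())
    pick (_ ∷ _ ∷ []) _ _ (s≤s (s≤s ()))
    pick (a ∷ b ∷ c ∷ _) ((a≢b ∷ a≢c ∷ _) ∷ (b≢c ∷ _) ∷ _) adj-u _ =
      a , b , c , adj-u (here refl) , adj-u (there (here refl)) , adj-u (there (there (here refl))) ,
      a≢b , a≢c , b≢c

  deg≤2-neighbour : ∀ {u p q v} → deg adj u ≤ 2 → adj u p ≡ true → adj u q ≡ true → p ≢ q →
                    adj u v ≡ true → v ≡ p ⊎ v ≡ q
  deg≤2-neighbour {u} {p} {q} {v} deg≤2 up uq p≢q uv with v Finₚ.≟ p | v Finₚ.≟ q
  ... | yes v≡p | _ = inj₁ v≡p
  ... | no _ | yes v≡q = inj₂ v≡q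
  ... | no v≢p | no v≢q with ≤-trans (Unique-⊆⇒length≤ three-distinct three⊆neighbours) deg≤2
    where
    three-distinct : Unique (p ∷ q ∷ v ∷ [])
    three-distinct = (p≢q ∷ (λ p≡v → v≢p (sym p≡v)) ∷ []) ∷ ((λ q≡v → v≢q (sym q≡v)) ∷ []) ∷ [] ∷ []
    three⊆neighbours : ∀ {z} → z ∈ p ∷ q ∷ v ∷ [] → z ∈ neighbours u
    three⊆neighbours (here refl) = ∈-neighbours⁺ up
    three⊆neighbours (there (here refl)) = ∈-neighbours⁺ uq
    three⊆neighbours (there (there (here refl))) = ∈-neighbours⁺ uv
  ... | s≤s (s≤s ())

module Acyclic {n : ℕ} (adj : Adj n) (adj-sym : ∀ u v → adj u v ≡ adj v u)
               (adj-irrefl : ∀ u → adj u u ≡ false) (acyclic : ¬ HasCycle adj) where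
  open Graph adj
  open DecMembership (Finₚ._≟_ {n}) using (_∈?_)

  adj-flip : ∀ {u v} → adj u v ≡ true → adj v u ≡ true
  adj-flip {u} {v} uv = trans (adj-sym v u) uv

  adj⇒≢ : ∀ {u v} → adj u v ≡ true → u ≢ v
  adj⇒≢ {u} uu refl with trans (sym uu) (adj-irrefl u)
  ... | ()

  Chain-reverse : ∀ ps → Chain adj ps → Chain adj (reverse ps)
  Chain-reverse [] _ = _
  Chain-reverse (x ∷ []) _ = _
  Chain-reverse (x ∷ y ∷ ps) (xy , c) =
    subst (Chain adj) (sym (trans (unfold-reverse x (y ∷ ps)) (cong (_∷ʳ x) (unfold-reverse y ps))))
      (Chain-∷ʳ (reverse ps) (subst (Chain adj) (unfold-reverse y ps) (Chain-reverse (y ∷ ps) c)) (adj-flip xy))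

  SimplePath-reverse : ∀ {ps} → SimplePath ps → SimplePath (reverse ps)
  SimplePath-reverse {ps} (u , c) = Unique-resp-↭ (↭-sym (↭-reverse ps)) u , Chain-reverse ps c

  no-chord : ∀ {v w rest u} → SimplePath (v ∷ w ∷ rest) → adj v u ≡ true → u ∉ rest
  no-chord {v} {w} {rest} {u} (uq , ch) vu u∈ with ∈-∃++ u∈
  ... | pre , post , refl = acyclic (v , w ∷ pre ∷ʳ u , two≤ , Unique-++⁻ˡ cyc (subst Unique reassoc uq) ,
                                     Chain-∷ʳ (v ∷ w ∷ pre) (Chain-++⁻ˡ cyc (subst (Chain adj) reassoc ch)) (adj-flip vu))
    where
    cyc = v ∷ w ∷ pre ∷ʳ u
    reassoc : v ∷ w ∷ pre ++ [ u ] ++ post ≡ cyc ++ post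
    reassoc = cong (λ z → v ∷ w ∷ z) (sym (++-assoc pre [ u ] post))
    two≤ : 2 ≤ length (w ∷ pre ∷ʳ u)
    two≤ = s≤s (≤-trans (m≤n+m 1 (length pre)) (≤-reflexive (sym (length-++ pre))))

  forked-paths-diverge : ∀ {r a b} P Q → a ≢ b → SimplePath (r ∷ a ∷ P) → SimplePath (r ∷ b ∷ Q) →
                         lastOr a P ≢ lastOr b Q
  forked-paths-diverge {r} {a} {b} P Q a≢b (ua , ca) rbQ ends≡ with a ∈? (b ∷ Q)
  ... | yes (here a≡b) = a≢b a≡b
  ... | yes (there a∈Q) = no-chord rbQ (proj₁ ca) a∈Q
  forked-paths-diverge [] Q a≢b _ _ ends≡ | no a∉ = a∉ (subst (_∈ _) (sym ends≡) (lastOr-∈ _ Q))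
  forked-paths-diverge {r} {a} {b} (p ∷ P) Q a≢b ((r≢a ∷ r≢p ∷ _) ∷ uP , ra , cP) (uQ , cQ) ends≡ | no a∉ =
    forked-paths-diverge P (b ∷ Q) (λ p≡r → r≢p (sym p≡r)) (uP , cP)
      (((λ a≡r → r≢a (sym a≡r)) ∷ ∉⇒All≢ a∉) ∷ uQ , adj-flip ra , cQ) ends≡

  record FrontExtension (ps : List (Fin n)) : Set where
    field
      front : List (Fin n)
      end end′ : Fin n
      rest : List (Fin n)
      shape : front ++ ps ≡ end ∷ end′ ∷ rest
      simple : SimplePath (end ∷ end′ ∷ rest)
      end-only-end′ : ∀ y → adj end y ≡ true → y ≡ end′

  private
    extend-front′ : ∀ fuel v w rest → n < fuel + length (v ∷ w ∷ rest) → SimplePath (v ∷ w ∷ rest) →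
                    FrontExtension (v ∷ w ∷ rest)
    extend-front′ zero v w rest n<len (u , _) = ⊥-elim (<-irrefl refl (≤-trans n<len (Unique⇒length≤ u)))
    extend-front′ (suc fuel) v w rest n<len simple
      with any? (λ y → (adj v y Boolₚ.≟ true) ×-dec ¬? (y Finₚ.≟ w)) (allFin n)
    ... | no no-other = record
      { front = [] ; end = v ; end′ = w ; rest = rest ; shape = refl ; simple = simple
      ; end-only-end′ = only-w }
      where
      only-w : ∀ y → adj v y ≡ true → y ≡ w
      only-w y vy with y Finₚ.≟ w
      ... | yes y≡w = y≡w
      ... | no y≢w = ⊥-elim (no-other (lose (∈-allFin y) (vy , y≢w)))
    ... | yes other with satisfied other
    ... | y , vy , y≢w with y ∈? (v ∷ w ∷ rest)
    ...   | yes (here y≡v) = ⊥-elim (adj⇒≢ vy (sym y≡v))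
    ...   | yes (there (here y≡w)) = ⊥-elim (y≢w y≡w)
    ...   | yes (there (there y∈rest)) = ⊥-elim (no-chord simple vy y∈rest)
    ...   | no y∉ = record
      { front = front ++ [ y ] ; end = end ; end′ = end′ ; rest = rest′
      ; shape = trans (++-assoc front [ y ] _) shape ; simple = simple′ ; end-only-end′ = end-only-end′ }
      where
      open FrontExtension (extend-front′ fuel y v (w ∷ rest) (subst (n <_) (sym (+-suc fuel _)) n<len)
              (∉⇒All≢ y∉ ∷ proj₁ simple , adj-flip vy , proj₂ simple))
        renaming (rest to rest′; simple to simple′)

  extend-front : ∀ {v w rest} → SimplePath (v ∷ w ∷ rest) → FrontExtension (v ∷ w ∷ rest)
  extend-front {v} {w} {rest} = extend-front′ (suc n) v w rest (m≤m+n (suc n) _)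

  LeafOn : List (Fin n) → Fin n → Set
  LeafOn ps x = ∃ λ p → p ∈ ps × adj x p ≡ true × (∀ y → adj x y ≡ true → y ≡ p)

  LeafOn⇒deg≡1 : ∀ {ps x} → LeafOn ps x → deg adj x ≡ 1
  LeafOn⇒deg≡1 (_ , _ , xp , only-p) = deg≡1 xp only-p

  path-to-leaf : ∀ {r a} → adj r a ≡ true → ∃ λ middle →
                 SimplePath (r ∷ a ∷ middle) × LeafOn (r ∷ a ∷ middle) (lastOr a middle)
  path-to-leaf {r} {a} ra = reverse front , simple-r-a , subst (LeafOn _) (sym ends) end-leaf
    where
    open FrontExtension (extend-front ((((λ a≡r → adj⇒≢ ra (sym a≡r)) ∷ []) ∷ [] ∷ []) , adj-flip ra , _))
    reversed : reverse (end ∷ end′ ∷ rest) ≡ r ∷ a ∷ reverse front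
    reversed = trans (cong reverse (sym shape)) (reverse-++ front (a ∷ r ∷ []))
    simple-r-a : SimplePath (r ∷ a ∷ reverse front)
    simple-r-a = subst SimplePath reversed (SimplePath-reverse simple)
    ends : lastOr a (reverse front) ≡ end
    ends = lastOr-reverse {ys = end′ ∷ rest} (sym reversed)
    end-leaf : LeafOn (r ∷ a ∷ reverse front) end
    end-leaf = end′ , subst (end′ ∈_) reversed (∈-resp-↭ (↭-sym (↭-reverse (end ∷ end′ ∷ rest))) (there (here refl)))
             , proj₁ (proj₂ simple) , end-only-end′

  three-leaves : ∀ {r} → 3 ≤ deg adj r → ∃₂ λ x y → ∃ λ z →
    deg adj x ≡ 1 × deg adj y ≡ 1 × deg adj z ≡ 1 × x ≢ y × x ≢ z × y ≢ z
  three-leaves r3 with three-neighbours _ r3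
  ... | a , b , c , ra , rb , rc , a≢b , a≢c , b≢c
    with path-to-leaf ra | path-to-leaf rb | path-to-leaf rc
  ... | A , pa , la | B , pb , lb | C , pc , lc =
    _ , _ , _ , LeafOn⇒deg≡1 la , LeafOn⇒deg≡1 lb , LeafOn⇒deg≡1 lc ,
    forked-paths-diverge A B a≢b pa pb , forked-paths-diverge A C a≢c pa pc , forked-paths-diverge B C b≢c pb pc

  ends-or-interior : ∀ {x} h t → SimplePath (h ∷ t) → x ∈ h ∷ t →
    x ≡ h ⊎ x ≡ lastOr h t ⊎
    ∃₂ λ p q → p ∈ h ∷ t × q ∈ h ∷ t × p ≢ q × adj x p ≡ true × adj x q ≡ true
  ends-or-interior h t _ (here x≡h) = inj₁ x≡h
  ends-or-interior h (b ∷ []) _ (there (here refl)) = inj₂ (inj₁ refl)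
  ends-or-interior h (b ∷ c ∷ t) ((h∉ ∷ u) , hb , bc , ch) (there x∈) with ends-or-interior b (c ∷ t) (u , bc , ch) x∈
  ... | inj₁ refl = inj₂ (inj₂ (h , c , here refl , there (there (here refl)) ,
                                All.lookup h∉ (there (here refl)) , adj-flip hb , bc))
  ... | inj₂ (inj₁ x≡last) = inj₂ (inj₁ x≡last)
  ... | inj₂ (inj₂ (p , q , p∈ , q∈ , interior)) = inj₂ (inj₂ (p , q , there p∈ , there q∈ , interior))

  private
    head-neighbour-index : ∀ x ps (j : Fin (length ps)) → SimplePath (x ∷ ps) →
                           adj x (lookup ps j) ≡ true → toℕ j ≡ 0
    head-neighbour-index x (w ∷ rest) Fin.zero _ _ = refl
    head-neighbour-index x (w ∷ rest) (Fin.suc j) sp xj = ⊥-elim (no-chord sp xj (∈-lookup j))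

  adjacent⇒consecutive : ∀ ps (i j : Fin (length ps)) → SimplePath ps →
    adj (lookup ps i) (lookup ps j) ≡ true → suc (toℕ i) ≡ toℕ j ⊎ suc (toℕ j) ≡ toℕ i
  adjacent⇒consecutive (x ∷ ps) Fin.zero Fin.zero _ xx = ⊥-elim (adj⇒≢ xx refl)
  adjacent⇒consecutive (x ∷ ps) Fin.zero (Fin.suc j) sp xj =
    inj₁ (cong suc (sym (head-neighbour-index x ps j sp xj)))
  adjacent⇒consecutive (x ∷ ps) (Fin.suc i) Fin.zero sp ix =
    inj₂ (cong suc (sym (head-neighbour-index x ps i sp (adj-flip ix))))
  adjacent⇒consecutive (x ∷ ps) (Fin.suc i) (Fin.suc j) ((_ ∷ u) , c) ij
    with adjacent⇒consecutive ps i j (u , Chain-++⁻ʳ [ x ] c) ij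
  ... | inj₁ i+1≡j = inj₁ (cong suc i+1≡j)
  ... | inj₂ j+1≡i = inj₂ (cong suc j+1≡i)

  spanning-path⇒IsPathGraph : ∀ {ps} → SimplePath ps → (∀ u → u ∈ ps) → IsPathGraph adj
  spanning-path⇒IsPathGraph {ps} sp@(u , c) spans = σ , σ-injective , λ i j → mk⇔ (to i j) (from i j)
    where
    length≡n : length ps ≡ n
    length≡n = ≤-antisym (Unique⇒length≤ u)
      (≤-trans (≤-reflexive (sym (length-tabulate {n = n} (λ i → i))))
               (Unique-⊆⇒length≤ (allFin⁺ n) (λ {z} _ → spans z)))
    ι : Fin n → Fin (length ps)
    ι = cast (sym length≡n)
    σ : Fin n → Fin n
    σ i = lookup ps (ι i)
    toℕ-ι : ∀ i → toℕ (ι i) ≡ toℕ i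
    toℕ-ι = Finₚ.toℕ-cast (sym length≡n)
    σ-injective : ∀ {i j} → σ i ≡ σ j → i ≡ j
    σ-injective {i} {j} eq =
      Finₚ.toℕ-injective (trans (sym (toℕ-ι i)) (trans (cong toℕ (lookup-injective u eq)) (toℕ-ι j)))
    reindex : ∀ i j → suc (toℕ (ι i)) ≡ toℕ (ι j) → suc (toℕ i) ≡ toℕ j
    reindex i j eq = trans (cong suc (sym (toℕ-ι i))) (trans eq (toℕ-ι j))
    unreindex : ∀ i j → suc (toℕ i) ≡ toℕ j → suc (toℕ (ι i)) ≡ toℕ (ι j)
    unreindex i j eq = trans (cong suc (toℕ-ι i)) (trans eq (sym (toℕ-ι j)))
    to : ∀ i j → adj (σ i) (σ j) ≡ true → suc (toℕ i) ≡ toℕ j ⊎ suc (toℕ j) ≡ toℕ i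
    to i j σiσj with adjacent⇒consecutive ps (ι i) (ι j) sp σiσj
    ... | inj₁ eq = inj₁ (reindex i j eq)
    ... | inj₂ eq = inj₂ (reindex j i eq)
    from : ∀ i j → suc (toℕ i) ≡ toℕ j ⊎ suc (toℕ j) ≡ toℕ i → adj (σ i) (σ j) ≡ true
    from i j (inj₁ eq) = Chain-lookup ps (ι i) (ι j) c (unreindex i j eq)
    from i j (inj₂ eq) = adj-flip (Chain-lookup ps (ι j) (ι i) c (unreindex j i eq))

  deg≤2⇒IsPathGraph : (∀ u v → Walk adj u v) → (∀ u → deg adj u ≤ 2) →
                      ∀ {x₀ y₀} → adj x₀ y₀ ≡ true → IsPathGraph adj
  deg≤2⇒IsPathGraph connected deg≤2 {x₀} {y₀} x₀y₀ with path-to-leaf x₀y₀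
  ... | M , simple-Q , (p , p∈Q , _ , only-p) = spanning-path⇒IsPathGraph simple spans
    where
    open FrontExtension (extend-front simple-Q)
    P = end ∷ end′ ∷ rest
    closed : ∀ {x y} → x ∈ P → adj x y ≡ true → y ∈ P
    closed x∈ xy with ends-or-interior end (end′ ∷ rest) simple x∈
    ... | inj₁ refl = subst (_∈ P) (sym (end-only-end′ _ xy)) (there (here refl))
    ... | inj₂ (inj₁ refl) =
      subst (_∈ P) (sym (only-p _ (subst (λ x → adj x _ ≡ true) (lastOr-++-≡ front shape) xy)))
        (subst (_ ∈_) shape (∈-++⁺ʳ front p∈Q))
    ... | inj₂ (inj₂ (q , q′ , q∈ , q′∈ , q≢q′ , xq , xq′)) with deg≤2-neighbour (deg≤2 _) xq xq′ q≢q′ xy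
    ...   | inj₁ refl = q∈
    ...   | inj₂ refl = q′∈
    spans : ∀ u → u ∈ P
    spans u = walk-within closed (here refl) (connected end u)

-- Edge lists

module Edges {n : ℕ} where

  endpoints : List (Edge n) → List (Fin n)
  endpoints [] = []
  endpoints ((a , b) ∷ es) = a ∷ b ∷ endpoints es

  endpoints-++ : ∀ es fs → endpoints (es ++ fs) ≡ endpoints es ++ endpoints fs
  endpoints-++ [] fs = refl
  endpoints-++ ((a , b) ∷ es) fs = cong (λ zs → a ∷ b ∷ zs) (endpoints-++ es fs)

  length-endpoints : ∀ es → length (endpoints es) ≡ length es + length es
  length-endpoints [] = refl
  length-endpoints ((a , b) ∷ es) = cong suc (trans (cong suc (length-endpoints es)) (sym (+-suc _ _)))

  EdgeIn : List (Fin n) → Edge n → Set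
  EdgeIn ps (a , b) = a ∈ ps × b ∈ ps

  EdgeIn-endpoints : ∀ {es e} → e ∈ es → EdgeIn (endpoints es) e
  EdgeIn-endpoints {(a , b) ∷ es} (here refl) = here refl , there (here refl)
  EdgeIn-endpoints {(a , b) ∷ es} (there e∈) =
    there (there (proj₁ (EdgeIn-endpoints e∈))) , there (there (proj₂ (EdgeIn-endpoints e∈)))

  _∉ₑ_ : Fin n → Edge n → Set
  x ∉ₑ (c , d) = x ≢ c × x ≢ d

  normEdge-≡ : ∀ {a b c d : Fin n} → normEdge (a , b) ≡ normEdge (c , d) → (a ≡ c × b ≡ d) ⊎ (a ≡ d × b ≡ c)
  normEdge-≡ {a} {b} {c} {d} eq with toℕ a ≤ᵇ toℕ b | toℕ c ≤ᵇ toℕ d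
  ... | true  | true  = inj₁ (cong proj₁ eq , cong proj₂ eq)
  ... | true  | false = inj₂ (cong proj₁ eq , cong proj₂ eq)
  ... | false | true  = inj₂ (cong proj₂ eq , cong proj₁ eq)
  ... | false | false = inj₁ (cong proj₂ eq , cong proj₁ eq)

  normEdge-≢ˡ : ∀ {a b} f → a ∉ₑ f → normEdge (a , b) ≢ normEdge f
  normEdge-≢ˡ (c , d) (a≢c , a≢d) eq with normEdge-≡ eq
  ... | inj₁ (a≡c , _) = a≢c a≡c
  ... | inj₂ (a≡d , _) = a≢d a≡d

  normEdge-≢ʳ : ∀ {a b} f → b ∉ₑ f → normEdge (a , b) ≢ normEdge f
  normEdge-≢ʳ (c , d) (b≢c , b≢d) eq with normEdge-≡ eq
  ... | inj₁ (_ , b≡d) = b≢d b≡d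
  ... | inj₂ (_ , b≡c) = b≢c b≡c

  DistinctEdges : List (Edge n) → Set
  DistinctEdges es = Unique (map normEdge es)

  DistinctEdges-++ : ∀ {es fs} → DistinctEdges es → DistinctEdges fs →
                     (∀ {e f} → e ∈ es → f ∈ fs → normEdge e ≢ normEdge f) → DistinctEdges (es ++ fs)
  DistinctEdges-++ {es} {fs} des dfs apart =
    subst Unique (sym (map-++ normEdge es fs)) (Uniqueₚ.++⁺ des dfs disjoint)
    where
    disjoint : ∀ {v} → ¬ (v ∈ map normEdge es × v ∈ map normEdge fs)
    disjoint (v∈es , v∈fs) with ∈-map⁻ normEdge v∈es | ∈-map⁻ normEdge v∈fs
    ... | e , e∈ , refl | f , f∈ , eq = apart e∈ f∈ eq

  Unique-endpoints⇒DistinctEdges : ∀ es → Unique (endpoints es) → DistinctEdges es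
  Unique-endpoints⇒DistinctEdges [] _ = []
  Unique-endpoints⇒DistinctEdges ((a , b) ∷ es) (a∉ ∷ (_ ∷ u)) =
    All.tabulate new ∷ Unique-endpoints⇒DistinctEdges es u
    where
    new : ∀ {y} → y ∈ map normEdge es → normEdge (a , b) ≢ y
    new y∈ with ∈-map⁻ normEdge y∈
    ... | f , f∈ , refl = normEdge-≢ˡ f (All.lookup a∉ (there (proj₁ (EdgeIn-endpoints f∈))) ,
                                         All.lookup a∉ (there (proj₂ (EdgeIn-endpoints f∈))))

  edgeCard≡length : ∀ {es} → DistinctEdges es → edgeCard es ≡ length es
  edgeCard≡length {es} d = trans (cong length (deduplicate-Unique _ d)) (length-map normEdge es)

open Edges

-- Definitionally equal to Proc.range a b: the list a, a + 1, …, b.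
interval : ℕ → ℕ → List ℕ
interval a b = map (a +_) (upTo (suc b ∸ a))

private
  offset≤ : ∀ a b t → t < suc b ∸ a → a + t ≤ b
  offset≤ zero b t (s≤s t≤b) = t≤b
  offset≤ (suc a) zero t t<0∸a = contradiction (subst (suc t ≤_) (0∸n≡0 a) t<0∸a) λ ()
  offset≤ (suc a) (suc b) t t< = s≤s (offset≤ a b t t<)

∈-interval⁻ : ∀ {a b i} → i ∈ interval a b → a ≤ i × i ≤ b
∈-interval⁻ {a} {b} i∈ with ∈-map⁻ (a +_) i∈
... | t , t∈ , refl = m≤m+n a t , offset≤ a b t (∈-upTo⁻ t∈)

length-map-interval : ∀ {A : Set} (g : ℕ → A) a b → length (map g (interval a b)) ≡ suc b ∸ a
length-map-interval g a b =
  trans (length-map g (interval a b)) (trans (length-map (a +_) (upTo (suc b ∸ a))) (length-upTo (suc b ∸ a)))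

∈-map-interval⁻ : ∀ {A : Set} (g : ℕ → A) {a b e} → e ∈ map g (interval a b) → ∃ λ i → (a ≤ i × i ≤ b) × e ≡ g i
∈-map-interval⁻ g e∈ with ∈-map⁻ g e∈
... | i , i∈ , refl = i , ∈-interval⁻ i∈ , refl

map-interval-Distinct : ∀ {n} (g : ℕ → Edge n) a b →
  (∀ {i j} → a ≤ i → i < j → j ≤ b → normEdge (g i) ≢ normEdge (g j)) → DistinctEdges (map g (interval a b))
map-interval-Distinct g a b apart = subst Unique (sym as-applyUpTo)
  (AllPairsₚ.applyUpTo⁺₁ _ (suc b ∸ a) λ {t} {u} t<u u<k →
    apart (m≤m+n a t) (+-monoʳ-< a t<u) (offset≤ a b u u<k))
  where
  as-applyUpTo : map normEdge (map g (interval a b)) ≡ applyUpTo (λ t → normEdge (g (a + t))) (suc b ∸ a)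
  as-applyUpTo = trans (sym (map-∘ (interval a b)))
                  (trans (sym (map-∘ (upTo (suc b ∸ a)))) (map-upTo _ (suc b ∸ a)))

-- Positions i ∈ [a, b] are paired with s ∸ i; the condition b < s ∸ b keeps the two halves apart.
module Folding {n : ℕ} (f : ℕ → Fin n) (m : ℕ)
  (f-injective : ∀ {i j} → 1 ≤ i → i ≤ m → 1 ≤ j → j ≤ m → f i ≡ f j → i ≡ j)
  (s a b : ℕ) (1≤a : 1 ≤ a) (b<s∸b : b < s ∸ b) (s∸a≤m : s ∸ a ≤ m) where

  folded : List (Edge n)
  folded = map (λ i → (f i , f (s ∸ i))) (interval a b)

  private
    record Position (i : ℕ) : Set where
      field
        1≤i : 1 ≤ i
        i≤m : i ≤ m
        b<partner : b < s ∸ i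
        partner≤m : s ∸ i ≤ m

    position : ∀ {i} → a ≤ i → i ≤ b → Position i
    position {i} a≤i i≤b = record
      { 1≤i = ≤-trans 1≤a a≤i
      ; i≤m = ≤-trans (≤-trans i≤b (<⇒≤ b<s∸b)) (≤-trans (∸-monoʳ-≤ s (≤-trans a≤i i≤b)) s∸a≤m)
      ; b<partner = ≤-trans b<s∸b (∸-monoʳ-≤ s i≤b)
      ; partner≤m = ≤-trans (∸-monoʳ-≤ s a≤i) s∸a≤m }

    1≤partner : ∀ {i} → Position i → 1 ≤ s ∸ i
    1≤partner p = ≤-trans (s≤s z≤n) (Position.b<partner p)

  f-≢ : ∀ {i j} → 1 ≤ i → i ≤ m → 1 ≤ j → j ≤ m → i ≢ j → f i ≢ f j
  f-≢ 1≤i i≤m 1≤j j≤m i≢j fi≡fj = i≢j (f-injective 1≤i i≤m 1≤j j≤m fi≡fj)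

  folded-Distinct : DistinctEdges folded
  folded-Distinct = map-interval-Distinct _ a b λ {i} {j} a≤i i<j j≤b →
    let pi = position a≤i (<⇒≤ (≤-trans i<j j≤b)) ; pj = position (≤-trans a≤i (<⇒≤ i<j)) j≤b
        open Position
    in normEdge-≢ˡ _
         ( f-≢ (1≤i pi) (i≤m pi) (1≤i pj) (i≤m pj) (<⇒≢ i<j)
         , f-≢ (1≤i pi) (i≤m pi) (1≤partner pj) (partner≤m pj)
               (<⇒≢ (≤-trans (≤-trans i<j j≤b) (<⇒≤ (b<partner pj)))))

  folded-avoids : ∀ {k} → 1 ≤ k → k ≤ m → k < a ⊎ b < k → k < s ∸ b → All (f k ∉ₑ_) folded
  folded-avoids {k} 1≤k k≤m outside k<s∸b = All.tabulate λ e∈ → avoid (∈-map-interval⁻ _ e∈)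
    where
    avoid : ∀ {e} → ∃ (λ i → (a ≤ i × i ≤ b) × e ≡ (f i , f (s ∸ i))) → f k ∉ₑ e
    avoid (i , (a≤i , i≤b) , refl) =
      f-≢ 1≤k k≤m (1≤i p) (i≤m p) k≢i ,
      f-≢ 1≤k k≤m (1≤partner p) (partner≤m p) (<⇒≢ (≤-trans k<s∸b (∸-monoʳ-≤ s i≤b)))
      where
      open Position
      p = position a≤i i≤b
      k≢i : k ≢ i
      k≢i = apart outside
        where
        apart : k < a ⊎ b < k → k ≢ i
        apart (inj₁ k<a) = <⇒≢ (≤-trans k<a a≤i)
        apart (inj₂ b<k) k≡i = <⇒≢ (≤-trans (s≤s i≤b) b<k) (sym k≡i)

  folded-within : ∀ {ps} → (∀ {i} → 1 ≤ i → i ≤ m → f i ∈ ps) → All (EdgeIn ps) folded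
  folded-within f∈ = All.tabulate λ e∈ → within (∈-map-interval⁻ _ e∈)
    where
    within : ∀ {e} → ∃ (λ i → (a ≤ i × i ≤ b) × e ≡ (f i , f (s ∸ i))) → EdgeIn _ e
    within (i , (a≤i , i≤b) , refl) = f∈ (1≤i p) (i≤m p) , f∈ (1≤partner p) (partner≤m p)
      where
      open Position
      p = position a≤i i≤b

suc-∸1 : ∀ {l} → 1 ≤ l → suc (l ∸ 1) ≡ l
suc-∸1 {suc l} _ = refl

module LeafCycle {n : ℕ} (g : ℕ → Fin n) (l : ℕ)
  (g-injective : ∀ {i j} → 1 ≤ i → i ≤ l → 1 ≤ j → j ≤ l → g i ≡ g j → i ≡ j) (3≤l : 3 ≤ l) where

  path : List (Edge n)
  path = map (λ i → (g i , g (suc i))) (interval 1 (l ∸ 1))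

  closing : Edge n
  closing = (g 1 , g l)

  private
    1≤l : 1 ≤ l
    1≤l = ≤-trans (s≤s z≤n) 3≤l

    suc≤l : ∀ {i} → i ≤ l ∸ 1 → suc i ≤ l
    suc≤l i≤ = ≤-trans (s≤s i≤) (≤-reflexive (suc-∸1 1≤l))

    ≤l : ∀ {i} → i ≤ l ∸ 1 → i ≤ l
    ≤l i≤ = <⇒≤ (suc≤l i≤)

    g-≢ : ∀ {i j} → 1 ≤ i → i ≤ l → 1 ≤ j → j ≤ l → i ≢ j → g i ≢ g j
    g-≢ 1≤i i≤l 1≤j j≤l i≢j gi≡gj = i≢j (g-injective 1≤i i≤l 1≤j j≤l gi≡gj)

  path-Distinct : DistinctEdges path
  path-Distinct = map-interval-Distinct _ 1 (l ∸ 1) λ {i} {j} 1≤i i<j j≤ →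
    let i≤ = <⇒≤ (≤-trans i<j j≤) ; 1≤j = ≤-trans 1≤i (<⇒≤ i<j)
    in normEdge-≢ˡ _ ( g-≢ 1≤i (≤l i≤) 1≤j (≤l j≤) (<⇒≢ i<j)
                     , g-≢ 1≤i (≤l i≤) (s≤s z≤n) (suc≤l j≤) (<⇒≢ (≤-trans i<j (n≤1+n j))))

  closing-new : All (λ e → normEdge e ≢ normEdge closing) path
  closing-new = All.tabulate λ e∈ → new (∈-map-interval⁻ _ e∈)
    where
    new : ∀ {e} → ∃ (λ i → (1 ≤ i × i ≤ l ∸ 1) × e ≡ (g i , g (suc i))) → normEdge e ≢ normEdge closing
    new (suc zero , (_ , i≤) , refl) =
      normEdge-≢ʳ closing (g-≢ (s≤s z≤n) (suc≤l i≤) (s≤s z≤n) 1≤l (λ ())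
                          , g-≢ (s≤s z≤n) (suc≤l i≤) 1≤l ≤-refl (λ 2≡l → <⇒≢ 3≤l 2≡l))
    new (suc (suc i) , (_ , i≤) , refl) =
      normEdge-≢ˡ closing (g-≢ (s≤s z≤n) (≤l i≤) (s≤s z≤n) 1≤l (λ ())
                          , g-≢ (s≤s z≤n) (≤l i≤) 1≤l ≤-refl (<⇒≢ (suc≤l i≤)))

  length-path : length path ≡ l ∸ 1
  length-path = length-map-interval _ 1 (l ∸ 1)

  cycle-Distinct : DistinctEdges (closing ∷ path)
  cycle-Distinct = Allₚ.map⁺ (All.map (λ e≢c c≡e → e≢c (sym c≡e)) closing-new) ∷ path-Distinct

  path-closing-Distinct : DistinctEdges (path ++ [ closing ])
  path-closing-Distinct = DistinctEdges-++ path-Distinct ([] ∷ []) λ { e∈ (here refl) → All.lookup closing-new e∈ }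

  module _ {ps} (g∈ : ∀ {i} → 1 ≤ i → i ≤ l → g i ∈ ps) where

    path-within : All (EdgeIn ps) path
    path-within = All.tabulate λ e∈ → within (∈-map-interval⁻ _ e∈)
      where
      within : ∀ {e} → ∃ (λ i → (1 ≤ i × i ≤ l ∸ 1) × e ≡ (g i , g (suc i))) → EdgeIn ps e
      within (i , (1≤i , i≤) , refl) = g∈ 1≤i (≤l i≤) , g∈ (s≤s z≤n) (suc≤l i≤)

    closing-within : EdgeIn ps closing
    closing-within = g∈ (s≤s z≤n) 1≤l , g∈ 1≤l ≤-refl

-- The procedure

module PairingLoop {n : ℕ} (adj : Adj n) (r : Fin n) (inB : Fin n → Fin n → Bool) (vs ws : List (Fin n)) where
  open Proc adj r inB vs ws

  unmarked : List (Fin n × Bool) → List (Fin n)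
  unmarked st = map proj₁ (filterᵇ (λ p → not (proj₂ p)) st)

  unmarked-++ : ∀ st st′ → unmarked (st ++ st′) ≡ unmarked st ++ unmarked st′
  unmarked-++ st st′ =
    trans (cong (map proj₁) (filter-++ (λ p → T? (not (proj₂ p))) st st′))
          (map-++ proj₁ (filterᵇ _ st) (filterᵇ _ st′))

  FindMarkSpec : List (Fin n × Bool) → Maybe (Fin n × List (Fin n × Bool)) → Set
  FindMarkSpec st nothing = ⊤
  FindMarkSpec st (just (u , st′)) = unmarked st ↭ u ∷ unmarked st′

  findMark-spec : ∀ p st → FindMarkSpec st (findMark p st)
  findMark-spec p [] = _
  findMark-spec p ((w , true) ∷ st) with findMark p st | findMark-spec p st
  ... | nothing | _ = _
  ... | just _ | spec = spec
  findMark-spec p ((w , false) ∷ st) with p w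
  ... | true = ↭-refl
  ... | false with findMark p st | findMark-spec p st
  ...   | nothing | _ = _
  ...   | just (u , _) | spec = ↭-trans (prep w spec) (swap w u ↭-refl)

  pairLoop-↭ : ∀ st rest acc → let (st′ , acc′) = pairLoop st rest acc in
               endpoints acc′ ++ unmarked st′ ↭ endpoints acc ++ unmarked st ++ rest
  pairLoop-↭ st [] acc = ↭-reflexive (cong (endpoints acc ++_) (sym (++-identityʳ (unmarked st))))
  pairLoop-↭ st (w ∷ rest) acc with findMark (sep w) st | findMark-spec (sep w) st
  ... | just (u , st′) | spec = begin
    _                                                                ↭⟨ pairLoop-↭ (st′ ++ [ (w , true) ]) rest (acc ++ [ (w , u) ]) ⟩
    endpoints (acc ++ [ (w , u) ]) ++ unmarked (st′ ++ [ (w , true) ]) ++ rest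
      ≡⟨ cong₂ (λ E U → E ++ U ++ rest) (endpoints-++ acc _) (trans (unmarked-++ st′ _) (++-identityʳ _)) ⟩
    (endpoints acc ++ w ∷ u ∷ []) ++ unmarked st′ ++ rest            ≡⟨ ++-assoc (endpoints acc) _ _ ⟩
    endpoints acc ++ w ∷ u ∷ unmarked st′ ++ rest                    ↭⟨ ++⁺ˡ (endpoints acc) (↭-sym (shift w (u ∷ unmarked st′) rest)) ⟩
    endpoints acc ++ (u ∷ unmarked st′) ++ w ∷ rest                  ↭⟨ ++⁺ˡ (endpoints acc) (++⁺ʳ (w ∷ rest) (↭-sym spec)) ⟩
    endpoints acc ++ unmarked st ++ w ∷ rest                         ∎
    where open PermutationReasoning
  ... | nothing | _ = begin
    _                                                     ↭⟨ pairLoop-↭ (st ++ [ (w , false) ]) rest acc ⟩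
    endpoints acc ++ unmarked (st ++ [ (w , false) ]) ++ rest ≡⟨ cong (λ U → endpoints acc ++ U ++ rest) (unmarked-++ st _) ⟩
    endpoints acc ++ (unmarked st ++ [ w ]) ++ rest        ≡⟨ cong (endpoints acc ++_) (++-assoc (unmarked st) _ _) ⟩
    endpoints acc ++ unmarked st ++ w ∷ rest               ∎
    where open PermutationReasoning

  afterLoop-↭ : endpoints (proj₂ afterLoop) ++ xs ↭ ws
  afterLoop-↭ = pairLoop-↭ [] ws []

parity : ∀ k → (∃ λ h → k ≡ h + h × k % 2 ≡ 0) ⊎ (∃ λ h → k ≡ suc (h + h) × k % 2 ≡ 1)
parity zero = inj₁ (0 , refl , refl)
parity (suc zero) = inj₂ (0 , refl , refl)
parity (suc (suc k)) with parity k
... | inj₁ (h , refl , k%2) = inj₁ (suc h , cong suc (sym (+-suc h h)) , k%2)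
... | inj₂ (h , refl , k%2) = inj₂ (suc h , cong (suc ∘ suc) (sym (+-suc h h)) , k%2)

by-parity : ∀ {a p} {A : Set a} (P : A → Set p) k {x y z} →
  (k ≡ 0 → P x) → (∀ h → 1 ≤ h → k ≡ h + h → P y) → (∀ h → k ≡ suc (h + h) → P z) →
  P (if k ≡ᵇ 0 then x else (if k % 2 ≡ᵇ 0 then y else z))
by-parity P k A B C with parity k
... | inj₁ (zero , refl , _) = A refl
... | inj₁ (suc h , refl , k%2) rewrite k%2 = B (suc h) (s≤s z≤n) refl
... | inj₂ (h , refl , k%2) rewrite k%2 = C h refl

private
  length-caseB-arith : ∀ h l → 1 ≤ h → 1 ≤ l → (suc h ∸ 2) + ((l ∸ 1) + 2) ≡ l + h
  length-caseB-arith (suc h) (suc l) _ _ = shape h l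
    where
    shape : ∀ h l → h + (l + 2) ≡ suc l + suc h
    shape = solve-∀

  length-caseC-arith : ∀ h l → 1 ≤ l → h + (suc (l ∸ 1) + 1) ≡ l + suc h
  length-caseC-arith h (suc l) _ = shape h l
    where
    shape : ∀ h l → h + (suc l + 1) ≡ suc l + suc h
    shape = solve-∀

  odd+2 : ∀ h → suc (h + h) + 1 ≡ h + (h + 2)
  odd+2 = solve-∀

if-elim : ∀ {a p} {A : Set a} (P : A → Set p) b {x y} → P x → P y → P (if b then x else y)
if-elim P true px _ = px
if-elim P false _ py = py

module SecondPhase {n : ℕ} (adj : Adj n) (r : Fin n) (inB : Fin n → Fin n → Bool) (vs ws : List (Fin n))
  (vs-Unique : Unique vs) (3≤l : 3 ≤ length vs)
  (xs-Unique : Unique (Proc.xs adj r inB vs ws)) (xs∩vs : ∀ {a} → a ∈ Proc.xs adj r inB vs ws → a ∉ vs) where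
  open Proc adj r inB vs ws

  private
    nth-∈ : ∀ ps {k} → k < length ps → nth ps k ∈ ps
    nth-∈ (p ∷ ps) {zero} _ = here refl
    nth-∈ (p ∷ ps) {suc k} (s≤s k<) = there (nth-∈ ps k<)

    nth-injective : ∀ {ps} → Unique ps → ∀ {k k′} → k < length ps → k′ < length ps → nth ps k ≡ nth ps k′ → k ≡ k′
    nth-injective {_ ∷ _} _ {zero} {zero} _ _ _ = refl
    nth-injective {_ ∷ ps} (p∉ ∷ _) {zero} {suc k′} _ (s≤s k′<) eq = ⊥-elim (All.lookup p∉ (nth-∈ ps k′<) eq)
    nth-injective {_ ∷ ps} (p∉ ∷ _) {suc k} {zero} (s≤s k<) _ eq = ⊥-elim (All.lookup p∉ (nth-∈ ps k<) (sym eq))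
    nth-injective {_ ∷ _} (_ ∷ u) {suc k} {suc k′} (s≤s k<) (s≤s k′<) eq = cong suc (nth-injective u k< k′< eq)

  -- x and v index from 1, hence the shift by one.
  at-∈ : ∀ {ps i} → 1 ≤ i → i ≤ length ps → nth ps (i ∸ 1) ∈ ps
  at-∈ {ps} {suc i} _ i≤ = nth-∈ ps i≤

  at-injective : ∀ {ps} → Unique ps → ∀ {i j} → 1 ≤ i → i ≤ length ps → 1 ≤ j → j ≤ length ps →
                 nth ps (i ∸ 1) ≡ nth ps (j ∸ 1) → i ≡ j
  at-injective u {suc i} {suc j} _ i≤ _ j≤ eq = cong suc (nth-injective u i≤ j≤ eq)

  open LeafCycle v l (at-injective vs-Unique) 3≤l

  x∈xs : ∀ {i} → 1 ≤ i → i ≤ m → x i ∈ xs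
  x∈xs = at-∈

  x∈xs++vs : ∀ {i} → 1 ≤ i → i ≤ m → x i ∈ xs ++ vs
  x∈xs++vs 1≤i i≤m = ∈-++⁺ˡ (x∈xs 1≤i i≤m)

  v∈xs++vs : ∀ {i} → 1 ≤ i → i ≤ l → v i ∈ xs ++ vs
  v∈xs++vs 1≤i i≤l = ∈-++⁺ʳ xs (at-∈ {vs} 1≤i i≤l)

  unmarked-apart-from-leaves : ∀ {a b f} → a ∈ xs → EdgeIn vs f → normEdge (a , b) ≢ normEdge f
  unmarked-apart-from-leaves {a} {f = c , d} a∈ (c∈ , d∈) =
    normEdge-≢ˡ (c , d) ( (λ a≡c → xs∩vs a∈ (subst (_∈ vs) (sym a≡c) c∈))
                        , (λ a≡d → xs∩vs a∈ (subst (_∈ vs) (sym a≡d) d∈)))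

  apart-from-extra : ∀ {es e k b} → All (x k ∉ₑ_) es → e ∈ es → normEdge e ≢ normEdge (x k , b)
  apart-from-extra {e = e} avoids e∈ = ≢-sym (normEdge-≢ˡ e (All.lookup avoids e∈))

  private
    1≤l : 1 ≤ l
    1≤l = ≤-trans (s≤s z≤n) 3≤l

  Phase2Spec : List (Edge n) → Set
  Phase2Spec es = DistinctEdges es × length es ≡ l + ⌈ m /2⌉ × All (EdgeIn (xs ++ vs)) es

  caseA-spec : m ≡ 0 → Phase2Spec caseA
  caseA-spec m≡0 =
    path-closing-Distinct , length-caseA , Allₚ.++⁺ (path-within v∈xs++vs) (closing-within v∈xs++vs ∷ [])
    where
    length-caseA : length caseA ≡ l + ⌈ m /2⌉
    length-caseA = begin
      length (path ++ [ closing ])  ≡⟨ length-++ path ⟩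
      length path + 1               ≡⟨ cong (_+ 1) length-path ⟩
      (l ∸ 1) + 1                   ≡⟨ +-comm (l ∸ 1) 1 ⟩
      suc (l ∸ 1)                   ≡⟨ suc-∸1 1≤l ⟩
      l                             ≡⟨ sym (+-identityʳ l) ⟩
      l + 0                         ≡⟨ cong (λ k → l + ⌈ k /2⌉) (sym m≡0) ⟩
      l + ⌈ m /2⌉                   ∎
      where open ≡-Reasoning

  module CaseB (h : ℕ) (1≤h : 1 ≤ h) (m≡h+h : m ≡ h + h) where

    private
      ⌊m/2⌋≡h : ⌊ m /2⌋ ≡ h
      ⌊m/2⌋≡h = trans (cong ⌊_/2⌋ m≡h+h) (sym (n≡⌊n+n/2⌋ h))

      lowest-partner : m + 2 ∸ ⌊ m /2⌋ ≡ h + 2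
      lowest-partner = begin
        m + 2 ∸ ⌊ m /2⌋    ≡⟨ cong₂ (λ k j → k + 2 ∸ j) m≡h+h ⌊m/2⌋≡h ⟩
        (h + h) + 2 ∸ h    ≡⟨ cong (_∸ h) (+-assoc h h 2) ⟩
        h + (h + 2) ∸ h    ≡⟨ m+n∸m≡n h (h + 2) ⟩
        h + 2              ∎
        where open ≡-Reasoning

      below-lowest-partner : ∀ {k} → k ≤ suc h → k < m + 2 ∸ ⌊ m /2⌋
      below-lowest-partner {k} k≤ = subst (k <_) (sym lowest-partner) (≤-trans (s≤s k≤) (≤-reflexive (+-comm 2 h)))

      h+1≤m : h + 1 ≤ m
      h+1≤m = subst (h + 1 ≤_) (sym m≡h+h) (+-monoʳ-≤ h 1≤h)

    open Folding x m (at-injective xs-Unique) (m + 2) 2 ⌊ m /2⌋ (s≤s z≤n)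
                 (below-lowest-partner (≤-trans (≤-reflexive ⌊m/2⌋≡h) (n≤1+n h))) (≤-reflexive (m+n∸n≡m m 2))

    private
      c = ⌊ m /2⌋ + 1

      1≤c : 1 ≤ c
      1≤c = ≤-trans (s≤s z≤n) (≤-reflexive (+-comm 1 ⌊ m /2⌋))

      c≤m : c ≤ m
      c≤m = subst (λ j → j + 1 ≤ m) (sym ⌊m/2⌋≡h) h+1≤m

      1≤m : 1 ≤ m
      1≤m = ≤-trans 1≤c c≤m

      x1-avoids : All (x 1 ∉ₑ_) folded
      x1-avoids = folded-avoids (s≤s z≤n) 1≤m (inj₁ (s≤s (s≤s z≤n))) (below-lowest-partner (s≤s z≤n))

      xc-avoids : All (x c ∉ₑ_) folded
      xc-avoids = folded-avoids 1≤c c≤m (inj₂ (m<m+n ⌊ m /2⌋ (s≤s z≤n)))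
                    (below-lowest-partner (≤-reflexive (trans (cong (_+ 1) ⌊m/2⌋≡h) (+-comm h 1))))

      1≢c : 1 ≢ c
      1≢c 1≡c = <⇒≢ (≤-trans (s≤s 1≤h) (≤-reflexive (trans (+-comm 1 h) (cong (_+ 1) (sym ⌊m/2⌋≡h))))) 1≡c

      extras : ℕ → ℕ → List (Edge n)
      extras a b = (x 1 , v a) ∷ (x c , v b) ∷ []

      with-extras-Distinct : ∀ {a b} → 1 ≤ b → b ≤ l → DistinctEdges (folded ++ path ++ extras a b)
      with-extras-Distinct {a} {b} 1≤b b≤l =
        DistinctEdges-++ folded-Distinct (DistinctEdges-++ path-Distinct extras-Distinct path-apart-from-extras) folded-apart
        where
        extras-Distinct : DistinctEdges (extras a b)
        extras-Distinct =
          (normEdge-≢ˡ (x c , v b) ( (λ x1≡xc → 1≢c (at-injective xs-Unique (s≤s z≤n) 1≤m 1≤c c≤m x1≡xc))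
                                   , (λ x1≡vb → xs∩vs (x∈xs (s≤s z≤n) 1≤m) (subst (_∈ vs) (sym x1≡vb) (at-∈ 1≤b b≤l)))) ∷ [])
          ∷ [] ∷ []
        path-apart-from-extras : ∀ {e f} → e ∈ path → f ∈ extras a b → normEdge e ≢ normEdge f
        path-apart-from-extras e∈ (here refl) =
          ≢-sym (unmarked-apart-from-leaves (x∈xs (s≤s z≤n) 1≤m) (All.lookup (path-within at-∈) e∈))
        path-apart-from-extras e∈ (there (here refl)) =
          ≢-sym (unmarked-apart-from-leaves (x∈xs 1≤c c≤m) (All.lookup (path-within at-∈) e∈))
        folded-apart : ∀ {e f} → e ∈ folded → f ∈ path ++ extras a b → normEdge e ≢ normEdge f
        folded-apart e∈ f∈ with ∈-++⁻ path f∈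
        ... | inj₁ f∈path = unmarked-apart-from-leaves (proj₁ (All.lookup (folded-within x∈xs) e∈))
                                                       (All.lookup (path-within at-∈) f∈path)
        ... | inj₂ (here refl) = apart-from-extra {k = 1} x1-avoids e∈
        ... | inj₂ (there (here refl)) = apart-from-extra {k = c} xc-avoids e∈

      length-with-extras : ∀ a b → length (folded ++ path ++ extras a b) ≡ l + ⌈ m /2⌉
      length-with-extras a b = begin
        length (folded ++ path ++ extras a b)        ≡⟨ length-++ folded ⟩
        length folded + length (path ++ extras a b)  ≡⟨ cong₂ _+_ (length-map-interval _ 2 ⌊ m /2⌋)
                                                                   (trans (length-++ path) (cong (_+ 2) length-path)) ⟩
        (suc ⌊ m /2⌋ ∸ 2) + ((l ∸ 1) + 2)           ≡⟨ cong (λ j → (suc j ∸ 2) + ((l ∸ 1) + 2)) ⌊m/2⌋≡h ⟩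
        (suc h ∸ 2) + ((l ∸ 1) + 2)                 ≡⟨ length-caseB-arith h l 1≤h 1≤l ⟩
        l + h                                       ≡⟨ cong (l +_) (trans (n≡⌈n+n/2⌉ h) (cong ⌈_/2⌉ (sym m≡h+h))) ⟩
        l + ⌈ m /2⌉                                 ∎
        where open ≡-Reasoning

      with-extras-spec : ∀ {a b} → 1 ≤ a → a ≤ l → 1 ≤ b → b ≤ l → Phase2Spec (folded ++ path ++ extras a b)
      with-extras-spec {a} {b} 1≤a a≤l 1≤b b≤l =
        with-extras-Distinct {a} 1≤b b≤l , length-with-extras a b ,
        Allₚ.++⁺ (folded-within x∈xs++vs) (Allₚ.++⁺ (path-within v∈xs++vs)
          ((x∈xs++vs (s≤s z≤n) 1≤m , v∈xs++vs 1≤a a≤l) ∷ (x∈xs++vs 1≤c c≤m , v∈xs++vs 1≤b b≤l) ∷ []))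

    caseB-spec : Phase2Spec caseB
    caseB-spec = if-elim (λ D → Phase2Spec (folded ++ path ++ D)) (adj (x c) (v l))
                   (with-extras-spec 1≤l ≤-refl (s≤s z≤n) 1≤l) (with-extras-spec (s≤s z≤n) 1≤l 1≤l ≤-refl)

  module CaseC (h : ℕ) (m≡ : m ≡ suc (h + h)) where

    private
      ⌊m∸1/2⌋≡h : ⌊ (m ∸ 1) /2⌋ ≡ h
      ⌊m∸1/2⌋≡h = trans (cong (λ k → ⌊ (k ∸ 1) /2⌋) m≡) (sym (n≡⌊n+n/2⌋ h))

      c = ⌊ (m + 1) /2⌋

      c≡ : c ≡ suc h
      c≡ = trans (cong (λ k → ⌊ (k + 1) /2⌋) m≡)
             (trans (cong ⌊_/2⌋ (+-comm (suc (h + h)) 1)) (cong suc (sym (n≡⌊n+n/2⌋ h))))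

      lowest-partner : m + 1 ∸ ⌊ (m ∸ 1) /2⌋ ≡ h + 2
      lowest-partner = begin
        m + 1 ∸ ⌊ (m ∸ 1) /2⌋    ≡⟨ cong₂ (λ k j → k + 1 ∸ j) m≡ ⌊m∸1/2⌋≡h ⟩
        suc (h + h) + 1 ∸ h      ≡⟨ cong (_∸ h) (odd+2 h) ⟩
        h + (h + 2) ∸ h          ≡⟨ m+n∸m≡n h (h + 2) ⟩
        h + 2                    ∎
        where open ≡-Reasoning

      below-lowest-partner : ∀ {k} → k ≤ suc h → k < m + 1 ∸ ⌊ (m ∸ 1) /2⌋
      below-lowest-partner {k} k≤ = subst (k <_) (sym lowest-partner) (≤-trans (s≤s k≤) (≤-reflexive (+-comm 2 h)))

    open Folding x m (at-injective xs-Unique) (m + 1) 1 ⌊ (m ∸ 1) /2⌋ (s≤s z≤n)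
                 (below-lowest-partner (≤-trans (≤-reflexive ⌊m∸1/2⌋≡h) (n≤1+n h))) (≤-reflexive (m+n∸n≡m m 1))

    private
      1≤c : 1 ≤ c
      1≤c = subst (1 ≤_) (sym c≡) (s≤s z≤n)

      c≤m : c ≤ m
      c≤m = subst₂ _≤_ (sym c≡) (sym m≡) (s≤s (m≤m+n h h))

      xc-avoids : All (x c ∉ₑ_) folded
      xc-avoids = folded-avoids 1≤c c≤m (inj₂ (subst₂ _<_ (sym ⌊m∸1/2⌋≡h) (sym c≡) ≤-refl))
                    (below-lowest-partner (≤-reflexive c≡))

      cycle-within : All (EdgeIn vs) (closing ∷ path)
      cycle-within = closing-within at-∈ ∷ path-within at-∈

      with-extra-Distinct : ∀ a → DistinctEdges (folded ++ (closing ∷ path) ++ [ (x c , v a) ])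
      with-extra-Distinct a =
        DistinctEdges-++ folded-Distinct (DistinctEdges-++ cycle-Distinct ([] ∷ []) cycle-apart-from-extra) folded-apart
        where
        cycle-apart-from-extra : ∀ {e f} → e ∈ closing ∷ path → f ∈ [ (x c , v a) ] → normEdge e ≢ normEdge f
        cycle-apart-from-extra e∈ (here refl) =
          ≢-sym (unmarked-apart-from-leaves (x∈xs 1≤c c≤m) (All.lookup cycle-within e∈))
        folded-apart : ∀ {e f} → e ∈ folded → f ∈ (closing ∷ path) ++ [ (x c , v a) ] → normEdge e ≢ normEdge f
        folded-apart e∈ f∈ with ∈-++⁻ (closing ∷ path) f∈
        ... | inj₁ f∈cycle = unmarked-apart-from-leaves (proj₁ (All.lookup (folded-within x∈xs) e∈))
                                                        (All.lookup cycle-within f∈cycle)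
        ... | inj₂ (here refl) = apart-from-extra {k = c} xc-avoids e∈

      length-with-extra : ∀ a → length (folded ++ (closing ∷ path) ++ [ (x c , v a) ]) ≡ l + ⌈ m /2⌉
      length-with-extra a = begin
        length (folded ++ (closing ∷ path) ++ [ (x c , v a) ])  ≡⟨ length-++ folded ⟩
        length folded + length ((closing ∷ path) ++ [ _ ])        ≡⟨ cong₂ _+_ (length-map-interval _ 1 ⌊ (m ∸ 1) /2⌋)
                                                                       (trans (length-++ (closing ∷ path))
                                                                              (cong (λ k → suc k + 1) length-path)) ⟩
        (suc ⌊ (m ∸ 1) /2⌋ ∸ 1) + (suc (l ∸ 1) + 1)              ≡⟨ cong (λ j → j + (suc (l ∸ 1) + 1)) ⌊m∸1/2⌋≡h ⟩
        h + (suc (l ∸ 1) + 1)                                    ≡⟨ length-caseC-arith h l 1≤l ⟩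
        l + suc h                                                ≡⟨ cong (λ k → l + suc k) (n≡⌊n+n/2⌋ h) ⟩
        l + ⌈ suc (h + h) /2⌉                                    ≡⟨ cong (λ k → l + ⌈ k /2⌉) (sym m≡) ⟩
        l + ⌈ m /2⌉                                              ∎
        where open ≡-Reasoning

      with-extra-spec : ∀ {a} → 1 ≤ a → a ≤ l → Phase2Spec (folded ++ (closing ∷ path) ++ [ (x c , v a) ])
      with-extra-spec {a} 1≤a a≤l =
        with-extra-Distinct a , length-with-extra a ,
        Allₚ.++⁺ (folded-within x∈xs++vs)
          (Allₚ.++⁺ (closing-within v∈xs++vs ∷ path-within v∈xs++vs) ((x∈xs++vs 1≤c c≤m , v∈xs++vs 1≤a a≤l) ∷ []))

    caseC-spec : Phase2Spec caseC
    caseC-spec = if-elim (λ e → Phase2Spec (folded ++ (closing ∷ path) ++ [ e ])) (adj (x c) (v l))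
                   (with-extra-spec (s≤s z≤n) 1≤l) (with-extra-spec 1≤l ≤-refl)

  phase2-spec : Phase2Spec phase2
  phase2-spec = by-parity Phase2Spec m caseA-spec CaseB.caseB-spec CaseC.caseC-spec

⌈k+k+m/2⌉ : ∀ k m → ⌈ (k + k) + m /2⌉ ≡ k + ⌈ m /2⌉
⌈k+k+m/2⌉ zero m = refl
⌈k+k+m/2⌉ (suc k) m = trans (cong (λ j → ⌈ suc j + m /2⌉) (+-suc k k)) (cong suc (⌈k+k+m/2⌉ k m))

edge-count-arith : ∀ a l m → a + (l + ⌈ m /2⌉) ≡ ⌈ (2 * l + ((a + a) + m)) /2⌉
edge-count-arith a l m = begin
  a + (l + ⌈ m /2⌉)                  ≡⟨ regroup a l ⌈ m /2⌉ ⟩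
  (l + a) + ⌈ m /2⌉                  ≡⟨ sym (⌈k+k+m/2⌉ (l + a) m) ⟩
  ⌈ ((l + a) + (l + a)) + m /2⌉      ≡⟨ cong ⌈_/2⌉ (double a l m) ⟩
  ⌈ (2 * l + ((a + a) + m)) /2⌉      ∎
  where
  open ≡-Reasoning
  regroup : ∀ a l c → a + (l + c) ≡ (l + a) + c
  regroup = solve-∀
  double : ∀ a l m → ((l + a) + (l + a)) + m ≡ 2 * l + ((a + a) + m)
  double = solve-∀

module EdgeCount {n : ℕ} (adj : Adj n) (r : Fin n) (inB : Fin n → Fin n → Bool) (vs ws : List (Fin n))
  (vs-Unique : Unique vs) (3≤l : 3 ≤ length vs) (ws-Unique : Unique ws) (ws∩vs : ∀ {a} → a ∈ ws → a ∉ vs) where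
  open Proc adj r inB vs ws hiding (Eca)
  open PairingLoop adj r inB vs ws

  private
    A = proj₂ afterLoop

    A-xs-Unique : Unique (endpoints A ++ xs)
    A-xs-Unique = Unique-resp-↭ (↭-sym afterLoop-↭) ws-Unique

    ⊆ws : ∀ {a} → a ∈ endpoints A ++ xs → a ∈ ws
    ⊆ws = ∈-resp-↭ afterLoop-↭

    open SecondPhase adj r inB vs ws vs-Unique 3≤l (Unique-++⁻ʳ (endpoints A) A-xs-Unique)
                     (λ a∈ → ws∩vs (⊆ws (∈-++⁺ʳ (endpoints A) a∈)))

    loop-apart-from-phase2 : ∀ {e f} → e ∈ A → f ∈ phase2 → normEdge e ≢ normEdge f
    loop-apart-from-phase2 {e = a , b} {f = c , d} e∈ f∈ = normEdge-≢ˡ (c , d) (not-in c∈ , not-in d∈)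
      where
      a∈ : a ∈ endpoints A
      a∈ = proj₁ (EdgeIn-endpoints e∈)
      c∈ = proj₁ (All.lookup (proj₂ (proj₂ phase2-spec)) f∈)
      d∈ = proj₂ (All.lookup (proj₂ (proj₂ phase2-spec)) f∈)
      not-in : ∀ {z} → z ∈ xs ++ vs → a ≢ z
      not-in z∈ a≡z with ∈-++⁻ xs z∈
      ... | inj₁ z∈xs = Unique-++-apart (endpoints A) A-xs-Unique a∈ z∈xs a≡z
      ... | inj₂ z∈vs = ws∩vs (⊆ws (∈-++⁺ˡ a∈)) (subst (_∈ vs) (sym a≡z) z∈vs)

    Eca-Distinct : DistinctEdges (Eca adj r inB vs ws)
    Eca-Distinct = DistinctEdges-++ (Unique-endpoints⇒DistinctEdges A (Unique-++⁻ˡ (endpoints A) A-xs-Unique))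
                     (proj₁ phase2-spec) loop-apart-from-phase2

    length-ws : (length A + length A) + m ≡ length ws
    length-ws = trans (cong (_+ m) (sym (length-endpoints A)))
                      (trans (sym (length-++ (endpoints A))) (↭-length afterLoop-↭))

  edgeCard-Eca : edgeCard (Eca adj r inB vs ws) ≡ ⌈ (2 * length vs + length ws) /2⌉
  edgeCard-Eca = begin
    edgeCard (Eca adj r inB vs ws)               ≡⟨ edgeCard≡length Eca-Distinct ⟩
    length (Eca adj r inB vs ws)                 ≡⟨ length-++ A ⟩
    length A + length phase2                     ≡⟨ cong (length A +_) (proj₁ (proj₂ phase2-spec)) ⟩
    length A + (l + ⌈ m /2⌉)                     ≡⟨ edge-count-arith (length A) l m ⟩
    ⌈ (2 * l + ((length A + length A) + m)) /2⌉  ≡⟨ cong (λ k → ⌈ (2 * l + k) /2⌉) length-ws ⟩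
    ⌈ (2 * length vs + length ws) /2⌉            ∎
    where open ≡-Reasoning

length≡numDeg : ∀ {n} (adj : Adj n) {d} {L : List (Fin n)} → Unique L → (∀ u → u ∈ L ⇔ deg adj u ≡ d) →
                length L ≡ numDeg adj d
length≡numDeg {n} adj {d} L-Unique L≈ =
  Unique-same-members⇒length≡ L-Unique (filter⁺ has-deg? (allFin⁺ n)) λ u →
    mk⇔ (λ u∈L → ∈-filter⁺ has-deg? (∈-allFin u) (≡⇒≡ᵇ _ _ (Equivalence.to (L≈ u) u∈L)))
        (λ u∈ → Equivalence.from (L≈ u) (≡ᵇ⇒≡ _ _ (proj₂ (∈-filter⁻ has-deg? {xs = allFin n} u∈))))
  where
  has-deg? = λ u → T? (deg adj u ≡ᵇ d)

edge-exists : ∀ {n} (adj : Adj n) → (∀ u v → Walk adj u v) → 2 ≤ n → ∃₂ λ x y → adj x y ≡ true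
edge-exists adj connected (s≤s (s≤s _)) with connected Fin.zero (Fin.suc Fin.zero)
... | step {w = y} 0y _ = Fin.zero , y , 0y

non-path⇒3≤leaves : ∀ {n} (adj : Adj n) → IsTree adj → 2 ≤ n → ¬ IsPathGraph adj →
  ∀ r → (∀ u → deg adj u ≤ deg adj r) → ∀ {vs} → Unique vs → (∀ u → u ∈ vs ⇔ deg adj u ≡ 1) → 3 ≤ length vs
non-path⇒3≤leaves adj (adj-sym , adj-irrefl , connected , acyclic) 2≤n not-path r r-max {vs} vs-Unique vs-leaves =
  three-in-vs (three-leaves 3≤deg-r)
  where
  open Acyclic adj adj-sym adj-irrefl acyclic

  3≤deg-r : 3 ≤ deg adj r
  3≤deg-r with 3 ≤? deg adj r | edge-exists adj connected 2≤n
  ... | yes 3≤ | _ = 3≤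
  ... | no deg-r≱3 | _ , _ , xy =
    ⊥-elim (not-path (deg≤2⇒IsPathGraph connected (λ u → ≤-trans (r-max u) (≤-pred (≰⇒> deg-r≱3))) xy))

  three-in-vs : (∃₂ λ x y → ∃ λ z → deg adj x ≡ 1 × deg adj y ≡ 1 × deg adj z ≡ 1 × x ≢ y × x ≢ z × y ≢ z) →
                3 ≤ length vs
  three-in-vs (x , y , z , dx , dy , dz , x≢y , x≢z , y≢z) =
    Unique-⊆⇒length≤ {xs = x ∷ y ∷ z ∷ []} ((x≢y ∷ x≢z ∷ []) ∷ (y≢z ∷ []) ∷ [] ∷ [])
      λ { (here refl) → Equivalence.from (vs-leaves x) dx
        ; (there (here refl)) → Equivalence.from (vs-leaves y) dy
        ; (there (there (here refl))) → Equivalence.from (vs-leaves z) dz }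

lemma5 : ∀ {n : ℕ} (adj : Adj n) → IsTree adj → 4 ≤ n → ¬ IsPathGraph adj →
    (r : Fin n) → (∀ u → deg adj u ≤ deg adj r) →
    (vs : List (Fin n)) → Unique vs → (∀ u → (u ∈ vs) ⇔ (deg adj u ≡ 1)) →
    (ws : List (Fin n)) → Unique ws → (∀ u → (u ∈ ws) ⇔ (deg adj u ≡ 2)) →
    LevelOrdered adj r ws →
    (inB : Fin n → Fin n → Bool) →
    (∀ w v → (inB w v ≡ true) ⇔ (∃ λ ps → PathFromTo adj r v ps × w ∈ ps)) →
    edgeCard (Eca adj r inB vs ws) ≡ ⌈ (2 * numDeg adj 1 + numDeg adj 2) /2⌉
lemma5 adj tree 4≤n not-path r r-max vs vs-Unique vs-leaves ws ws-Unique ws-deg2 _ inB _ = begin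
  edgeCard (Eca adj r inB vs ws)           ≡⟨ EdgeCount.edgeCard-Eca adj r inB vs ws vs-Unique 3≤l ws-Unique ws∩vs ⟩
  ⌈ (2 * length vs + length ws) /2⌉        ≡⟨ cong₂ (λ a b → ⌈ (2 * a + b) /2⌉)
                                               (length≡numDeg adj vs-Unique vs-leaves) (length≡numDeg adj ws-Unique ws-deg2) ⟩
  ⌈ (2 * numDeg adj 1 + numDeg adj 2) /2⌉  ∎
  where
  open ≡-Reasoning

  3≤l : 3 ≤ length vs
  3≤l = non-path⇒3≤leaves adj tree (≤-trans (s≤s (s≤s z≤n)) 4≤n) not-path r r-max vs-Unique vs-leaves

  ws∩vs : ∀ {a} → a ∈ ws → a ∉ vs
  ws∩vs {a} a∈ws a∈vs with trans (sym (Equivalence.to (vs-leaves a) a∈vs)) (Equivalence.to (ws-deg2 a) a∈ws)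
  ... | ()
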